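{- Let $w$ be a Sturmian word with slope $\alpha$. Then (1) $1w$ is prefix normal if and only if $0w$ is Sturmian; and (2) if $0w$ is not Sturmian, then $1^{n}w$ is prefix normal for $n=\lceil 1/(1-\alpha)\rceil$.
   Context: Binary words are indexed from $1$; $P_w(i)$ is the number of $1$s in the prefix of length $i$ of $w$. An infinite binary word $w$ is prefix normal if for every $i\ge1$ every factor of $w$ of length $i$ has at most $P_w(i)$ ones. A word is balanced if any two factors of the same length differ in their number of $1$s by at most $1$. An infinite binary word is Sturmian if it is balanced and not ultimately periodic. The slope of an infinite word $w$ is $\lim_{i\to\infty}P_w(i)/i$ (for Sturmian words it exists and is an irrational number in $(0,1)$). -}

module Defs where

open import Data.Bool using (Bool; true; false)
open import Data.Nat using (ℕ; zero; suc; _+_; _*_; _∸_; _≤_; _<_)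
open import Data.Product using (_×_; Σ; ∃; ∃-syntax)
open import Data.Sum using (_⊎_)
open import Relation.Nullary using (¬_)
open import Relation.Binary.PropositionalEquality using (_≡_)

-- An infinite binary word. The paper's letter w_i (1-indexed) is  w (i ∸ 1)  here.
Word : Set
Word = ℕ → Bool

bit : Bool → ℕ
bit true  = 1
bit false = 0

-- ones w j i : number of 1s in the factor of length i starting at
-- (0-indexed) position j, i.e. the paper's factor w_{j+1} … w_{j+i}.
ones : Word → ℕ → ℕ → ℕ
ones w j zero    = 0
ones w j (suc i) = bit (w (j + i)) + ones w j i

P : Word → ℕ → ℕ
P w i = ones w 0 i

PrefixNormal : Word → Set
PrefixNormal w = ∀ i j → 1 ≤ i → ones w j i ≤ P w i

Balanced : Word → Set
Balanced w = ∀ i j k → ones w j i ≤ ones w k i + 1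

UltimatelyPeriodic : Word → Set
UltimatelyPeriodic w = ∃[ p ] ∃[ N ] (1 ≤ p × (∀ m → N ≤ m → w (m + p) ≡ w m))

Sturmian : Word → Set
Sturmian w = Balanced w × ¬ UltimatelyPeriodic w

_∷w_ : Bool → Word → Word
(b ∷w w) zero    = b
(b ∷w w) (suc m) = w m

ones-prefix : ℕ → Word → Word
ones-prefix zero    w = w
ones-prefix (suc n) w = true ∷w ones-prefix n w

-- Comparisons of a·α with b, where α = lim_{i→∞} P_w(i)/i is the slope,
-- phrased directly through the limit (no real numbers in the library).
-- a·α ≤ b  iff for every k ≥ 1, eventually a·P(i)/i < b + 1/k.
SlopeMulLe : Word → ℕ → ℕ → Set
SlopeMulLe w a b = ∀ k → 1 ≤ k → ∃[ N ] (∀ i → N ≤ i → 1 ≤ i →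
                     k * a * P w i < (k * b + 1) * i)

-- a·α > b  iff for some k ≥ 1, eventually a·P(i)/i ≥ b + 1/k.
SlopeMulGt : Word → ℕ → ℕ → Set
SlopeMulGt w a b = ∃[ k ] ∃[ N ] (1 ≤ k × (∀ i → N ≤ i →
                     (k * b + 1) * i ≤ k * a * P w i))

-- n = ⌈ 1/(1-α) ⌉, i.e. n ≥ 1, 1/(1-α) ≤ n and n-1 < 1/(1-α).
-- For 0<α<1:  1/(1-α) ≤ n  ⇔  n·α ≤ n-1 ;
--             n-1 < 1/(1-α) ⇔  n = 1  or  (n-1)·α > n-2  (n ≥ 2).
IsCeilInvOneMinusSlope : Word → ℕ → Set
IsCeilInvOneMinusSlope w n =
  1 ≤ n × SlopeMulLe w n (n ∸ 1) × (n ≡ 1 ⊎ SlopeMulGt w (n ∸ 1) (n ∸ 2))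

-- Part (1). The prefix of length i + 1 of 1w is 1 followed by the prefix of length i of w,
-- and that of 0w is 0 followed by it. Comparing the other factors with these prefixes shows
-- that prefix normality of 1w and balance of 0w both say exactly that every factor of length
-- i + 1 of w has at most 1 + P_w(i) ones; prepending a letter does not affect aperiodicity.
--
-- Part (2). Let n = c + 1 with n·α ≤ c. Prefix normality of 1ⁿw follows once every factor
-- of length n of w has at most c ones. For a balanced word, n·α ≤ c gives n·P_w(i) ≤ c·i + n.
-- If some factor of length n had n ones, balance would force every such factor to have at
-- least c ones, while their total over the first D positions is at most n·P_w(D + n), i.e.
-- c·D + O(1). So all but finitely many of them have exactly c ones, and two consecutive
-- factors of the same weight force w(m + n) = w(m): w would be ultimately periodic.
module Submission where

open import Defs
open import Data.Bool using (true; false)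
open import Data.Empty using (⊥-elim)
open import Data.Nat using (ℕ; zero; suc; _+_; _*_; _≤_; _<_; z≤n; s≤s; s≤s⁻¹; _≤?_; _≟_)
open import Data.Nat.Properties
open import Algebra.Properties.CommutativeSemigroup +-commutativeSemigroup using (x∙yz≈y∙xz)
open import Data.Nat.Tactic.RingSolver using (solve-∀)
open import Data.Product using (_×_; _,_; ∃-syntax; proj₁)
open import Data.Sum using (inj₁; inj₂)
open import Function.Base using (_∘_)
open import Function.Bundles using (_⇔_; mk⇔; Equivalence)
open import Relation.Nullary using (¬_; yes; no)
open import Relation.Binary.PropositionalEquality

open Equivalence using (to; from)

bit≤1 : ∀ b → bit b ≤ 1
bit≤1 true  = ≤-refl
bit≤1 false = z≤n

bit-injective : ∀ {a b} → bit a ≡ bit b → a ≡ b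
bit-injective {true}  {true}  _ = refl
bit-injective {false} {false} _ = refl

ones≤length : ∀ w j i → ones w j i ≤ i
ones≤length w j zero    = z≤n
ones≤length w j (suc i) = +-mono-≤ (bit≤1 (w (j + i))) (ones≤length w j i)

ones-+ : ∀ w j a b → ones w j (a + b) ≡ ones w j a + ones w (j + a) b
ones-+ w j a zero    = trans (cong (ones w j) (+-identityʳ a)) (sym (+-identityʳ _))
ones-+ w j a (suc b) = begin
  ones w j (a + suc b)
    ≡⟨ cong (ones w j) (+-suc a b) ⟩
  bit (w (j + (a + b))) + ones w j (a + b)
    ≡⟨ cong₂ (λ k x → bit (w k) + x) (sym (+-assoc j a b)) (ones-+ w j a b) ⟩
  bit (w (j + a + b)) + (ones w j a + ones w (j + a) b)
    ≡⟨ x∙yz≈y∙xz (bit (w (j + a + b))) (ones w j a) (ones w (j + a) b) ⟩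
  ones w j a + ones w (j + a) (suc b) ∎
  where open ≡-Reasoning

ones-suc-start : ∀ w m n → ones w m (suc n) ≡ bit (w m) + ones w (suc m) n
ones-suc-start w m zero    = cong (λ k → bit (w k) + 0) (+-identityʳ m)
ones-suc-start w m (suc n) = begin
  bit (w (m + suc n)) + ones w m (suc n)
    ≡⟨ cong₂ (λ k x → bit (w k) + x) (+-suc m n) (ones-suc-start w m n) ⟩
  bit (w (suc m + n)) + (bit (w m) + ones w (suc m) n)
    ≡⟨ x∙yz≈y∙xz (bit (w (suc m + n))) (bit (w m)) (ones w (suc m) n) ⟩
  bit (w m) + ones w (suc m) (suc n) ∎
  where open ≡-Reasoning

equal-window-weights⇒letter≡ : ∀ w m n → ones w m n ≡ ones w (suc m) n → w (m + n) ≡ w m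
equal-window-weights⇒letter≡ w m n eq = bit-injective (+-cancelʳ-≡ _ _ _ (begin
  bit (w (m + n)) + ones w m n        ≡⟨ ones-suc-start w m n ⟩
  bit (w m) + ones w (suc m) n        ≡⟨ cong (bit (w m) +_) (sym eq) ⟩
  bit (w m) + ones w m n              ∎))
  where open ≡-Reasoning

P-suc-mono : ∀ w i → P w i ≤ P w (suc i)
P-suc-mono w i = m≤n+m (P w i) (bit (w i))

ones-∷w : ∀ b u j i → ones (b ∷w u) (suc j) i ≡ ones u j i
ones-∷w b u j zero    = refl
ones-∷w b u j (suc i) = cong (bit (u (j + i)) +_) (ones-∷w b u j i)

P-∷w : ∀ b u i → P (b ∷w u) (suc i) ≡ bit b + P u i
P-∷w b u zero    = refl
P-∷w b u (suc i) = trans (cong (bit (u i) +_) (P-∷w b u i)) (x∙yz≈y∙xz (bit (u i)) (bit b) (P u i))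

¬ultimatelyPeriodic-∷w : ∀ b w → ¬ UltimatelyPeriodic w → ¬ UltimatelyPeriodic (b ∷w w)
¬ultimatelyPeriodic-∷w b w ¬up (p , N , 1≤p , periodic) =
  ¬up (p , N , 1≤p , λ m N≤m → periodic (suc m) (m≤n⇒m≤1+n N≤m))

prefixNormal-true∷w⇔ : ∀ w → PrefixNormal (true ∷w w) ⇔ (∀ i j → ones w j (suc i) ≤ suc (P w i))
prefixNormal-true∷w⇔ w = mk⇔ forward backward
  where
  forward : PrefixNormal (true ∷w w) → ∀ i j → ones w j (suc i) ≤ suc (P w i)
  forward pn i j = subst₂ _≤_ (ones-∷w true w j (suc i)) (P-∷w true w i) (pn (suc i) (suc j) (s≤s z≤n))

  backward : (∀ i j → ones w j (suc i) ≤ suc (P w i)) → PrefixNormal (true ∷w w)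
  backward bound (suc i) zero    _ = ≤-refl
  backward bound (suc i) (suc j) _ rewrite ones-∷w true w j (suc i) | P-∷w true w i = bound i j

balanced-false∷w⇔ : ∀ w → Balanced w → Balanced (false ∷w w) ⇔ (∀ i j → ones w j (suc i) ≤ suc (P w i))
balanced-false∷w⇔ w bal = mk⇔ forward backward
  where
  forward : Balanced (false ∷w w) → ∀ i j → ones w j (suc i) ≤ suc (P w i)
  forward bal₀ i j =
    subst₂ _≤_ (ones-∷w false w j (suc i)) (trans (cong (_+ 1) (P-∷w false w i)) (+-comm (P w i) 1))
               (bal₀ (suc i) (suc j) 0)

  backward : (∀ i j → ones w j (suc i) ≤ suc (P w i)) → Balanced (false ∷w w)
  backward bound zero    j       k       = z≤n
  backward bound (suc i) zero    zero    = m≤m+n _ 1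
  backward bound (suc i) zero    (suc k) rewrite P-∷w false w i | ones-∷w false w k (suc i) =
    ≤-trans (P-suc-mono w i) (bal (suc i) 0 k)
  backward bound (suc i) (suc j) zero    rewrite P-∷w false w i | ones-∷w false w j (suc i) =
    ≤-trans (bound i j) (≤-reflexive (+-comm 1 (P w i)))
  backward bound (suc i) (suc j) (suc k) rewrite ones-∷w false w j (suc i) | ones-∷w false w k (suc i) =
    bal (suc i) j k

prefixNormal-true∷w⇔sturmian-false∷w : ∀ w → Sturmian w → PrefixNormal (true ∷w w) ⇔ Sturmian (false ∷w w)
prefixNormal-true∷w⇔sturmian-false∷w w (bal , ¬up) = mk⇔
  (λ pn → from (balanced-false∷w⇔ w bal) (to (prefixNormal-true∷w⇔ w) pn)
        , ¬ultimatelyPeriodic-∷w false w ¬up)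
  (λ st₀ → from (prefixNormal-true∷w⇔ w) (to (balanced-false∷w⇔ w bal) (proj₁ st₀)))

ones-ones-prefix : ∀ m u j i → ones (ones-prefix m u) (m + j) i ≡ ones u j i
ones-ones-prefix zero    u j i = refl
ones-ones-prefix (suc m) u j i = trans (ones-∷w true (ones-prefix m u) (m + j) i) (ones-ones-prefix m u j i)

P-ones-prefix : ∀ m u i → P (ones-prefix m u) (m + i) ≡ m + P u i
P-ones-prefix zero    u i = refl
P-ones-prefix (suc m) u i = trans (P-∷w true (ones-prefix m u) (m + i)) (cong suc (P-ones-prefix m u i))

P-ones-prefix-≤ : ∀ m u i → i ≤ m → P (ones-prefix m u) i ≡ i
P-ones-prefix-≤ m       u zero    _         = refl
P-ones-prefix-≤ (suc m) u (suc i) (s≤s i≤m) =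
  trans (P-∷w true (ones-prefix m u) i) (cong suc (P-ones-prefix-≤ m u i i≤m))

ones-prefix-+ : ∀ a b u → ones-prefix (a + b) u ≡ ones-prefix a (ones-prefix b u)
ones-prefix-+ zero    b u = refl
ones-prefix-+ (suc a) b u = cong (true ∷w_) (ones-prefix-+ a b u)

P-true∷w-mono : ∀ u i → P u i ≤ P (true ∷w u) i
P-true∷w-mono u zero    = z≤n
P-true∷w-mono u (suc i) = begin
  bit (u i) + P u i  ≤⟨ +-monoˡ-≤ (P u i) (bit≤1 (u i)) ⟩
  1 + P u i          ≡⟨ P-∷w true u i ⟨
  P (true ∷w u) (suc i) ∎
  where open ≤-Reasoning

P-ones-prefix-mono : ∀ a b u i → P (ones-prefix b u) i ≤ P (ones-prefix (a + b) u) i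
P-ones-prefix-mono zero    b u i = ≤-refl
P-ones-prefix-mono (suc a) b u i =
  ≤-trans (P-ones-prefix-mono a b u i) (P-true∷w-mono (ones-prefix (a + b) u) i)

prefixNormal-ones-prefix : ∀ m u → (∀ j i → ones u j (m + i) ≤ m + P u i) →
                           PrefixNormal (ones-prefix m u)
prefixNormal-ones-prefix m u bound i j _ with ≤-total m j
... | inj₁ m≤j with m≤n⇒∃[o]m+o≡n m≤j
...   | j′ , refl = factor-of-u
  where
  factor-of-u : ones (ones-prefix m u) (m + j′) i ≤ P (ones-prefix m u) i
  factor-of-u rewrite ones-ones-prefix m u j′ i with ≤-total i m
  ... | inj₁ i≤m = subst (ones u j′ i ≤_) (sym (P-ones-prefix-≤ m u i i≤m)) (ones≤length u j′ i)
  ... | inj₂ m≤i with m≤n⇒∃[o]m+o≡n m≤i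
  ...   | i′ , refl rewrite P-ones-prefix m u i′ = bound j′ i′
prefixNormal-ones-prefix m u bound i j _ | inj₂ j≤m with m≤n⇒∃[o]m+o≡n j≤m
... | r , refl = begin
  ones (ones-prefix (j + r) u) j i    ≡⟨ cong (λ v → ones v j i) (ones-prefix-+ j r u) ⟩
  ones (ones-prefix j v) j i          ≡⟨ cong (λ k → ones (ones-prefix j v) k i) (+-identityʳ j) ⟨
  ones (ones-prefix j v) (j + 0) i    ≡⟨ ones-ones-prefix j v 0 i ⟩
  P v i                               ≤⟨ P-ones-prefix-mono j r u i ⟩
  P (ones-prefix (j + r) u) i         ∎
  where
  open ≤-Reasoning
  v : Word
  v = ones-prefix r u

window≤⇒prefix-bound : ∀ w c → Balanced w → (∀ j → ones w j (suc c) ≤ c) →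
                       ∀ j i → ones w j (suc c + i) ≤ suc c + P w i
window≤⇒prefix-bound w c bal window≤ j i = begin
  ones w j (suc c + i)                     ≡⟨ cong (ones w j) (+-comm (suc c) i) ⟩
  ones w j (i + suc c)                     ≡⟨ ones-+ w j i (suc c) ⟩
  ones w j i + ones w (j + i) (suc c)      ≤⟨ +-mono-≤ (bal i j 0) (window≤ (j + i)) ⟩
  P w i + 1 + c                            ≡⟨ rearrange (P w i) c ⟩
  suc c + P w i                            ∎
  where
  open ≤-Reasoning
  rearrange : ∀ p c → p + 1 + c ≡ suc c + p
  rearrange = solve-∀

partialSum : (ℕ → ℕ) → ℕ → ℕ
partialSum f zero    = 0
partialSum f (suc D) = f D + partialSum f D

partialSum-+ : ∀ f g D → partialSum (λ d → f d + g d) D ≡ partialSum f D + partialSum g D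
partialSum-+ f g zero    = refl
partialSum-+ f g (suc D) = begin
  f D + g D + partialSum (λ d → f d + g d) D        ≡⟨ cong (f D + g D +_) (partialSum-+ f g D) ⟩
  f D + g D + (partialSum f D + partialSum g D)     ≡⟨ rearrange (f D) (g D) (partialSum f D) (partialSum g D) ⟩
  f D + partialSum f D + (g D + partialSum g D)     ∎
  where
  open ≡-Reasoning
  rearrange : ∀ a b x y → a + b + (x + y) ≡ a + x + (b + y)
  rearrange = solve-∀

partialSum-cong : ∀ {f g} → (∀ d → f d ≡ g d) → ∀ D → partialSum f D ≡ partialSum g D
partialSum-cong f≡g zero    = refl
partialSum-cong f≡g (suc D) = cong₂ _+_ (f≡g D) (partialSum-cong f≡g D)

ones≡partialSum : ∀ w j i → ones w j i ≡ partialSum (λ t → bit (w (j + t))) i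
ones≡partialSum w j zero    = refl
ones≡partialSum w j (suc i) = cong (bit (w (j + i)) +_) (ones≡partialSum w j i)

windowSum≤ : ∀ w n D → partialSum (λ d → ones w d n) D ≤ n * P w (n + D)
windowSum≤ w zero    D = ≤-reflexive (zeros D)
  where
  zeros : ∀ D → partialSum (λ _ → 0) D ≡ 0
  zeros zero    = refl
  zeros (suc D) = zeros D
windowSum≤ w (suc n) D = begin
  partialSum (λ d → bit (w (d + n)) + ones w d n) D
    ≡⟨ partialSum-+ (λ d → bit (w (d + n))) (λ d → ones w d n) D ⟩
  partialSum (λ d → bit (w (d + n))) D + partialSum (λ d → ones w d n) D
    ≡⟨ cong (_+ windows) (partialSum-cong (λ d → cong (λ k → bit (w k)) (+-comm d n)) D) ⟩
  partialSum (λ d → bit (w (n + d))) D + partialSum (λ d → ones w d n) D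
    ≡⟨ cong (_+ windows) (ones≡partialSum w n D) ⟨
  ones w n D + partialSum (λ d → ones w d n) D
    ≤⟨ +-mono-≤ (m≤n+m (ones w n D) (P w n)) (windowSum≤ w n D) ⟩
  P w n + ones w n D + n * P w (n + D)
    ≡⟨ cong (_+ n * P w (n + D)) (ones-+ w 0 n D) ⟨
  P w (n + D) + n * P w (n + D)
    ≤⟨ *-monoʳ-≤ (suc n) (P-suc-mono w (n + D)) ⟩
  suc n * P w (suc n + D) ∎
  where
  open ≤-Reasoning
  windows : ℕ
  windows = partialSum (λ d → ones w d n) D

partialSum-lowerBound : ∀ f c → (∀ d → c ≤ f d) → ∀ D e → c * e + partialSum f D ≤ partialSum f (e + D)
partialSum-lowerBound f c f≥c D zero    = ≤-reflexive (cong (_+ partialSum f D) (*-zeroʳ c))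
partialSum-lowerBound f c f≥c D (suc e) = begin
  c * suc e + partialSum f D               ≡⟨ cong (_+ partialSum f D) (*-suc c e) ⟩
  c + c * e + partialSum f D               ≡⟨ +-assoc c (c * e) (partialSum f D) ⟩
  c + (c * e + partialSum f D)             ≤⟨ +-mono-≤ (f≥c (e + D)) (partialSum-lowerBound f c f≥c D e) ⟩
  f (e + D) + partialSum f (e + D)         ∎
  where open ≤-Reasoning

-- Only doubly negated: the position from which on f stays at c cannot be computed.
eventually≡lowerBound : ∀ f c B → (∀ d → c ≤ f d) → (∀ D → partialSum f D ≤ c * D + B) →
                        ¬ ¬ (∃[ D ] (∀ m → D ≤ m → f m ≡ c))
eventually≡lowerBound f c B f≥c bounded ¬eventually =
  unbounded (suc B) λ (D , above) → 1+n≰n (+-cancelˡ-≤ (c * D) (suc B) B (≤-trans above (bounded D)))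
  where
  unbounded : ∀ t → ¬ ¬ (∃[ D ] (c * D + t ≤ partialSum f D))
  unbounded zero    never = never (0 , ≤-reflexive (trans (+-identityʳ (c * 0)) (*-zeroʳ c)))
  unbounded (suc t) never = unbounded t λ (D , above) → ¬eventually (D , constant D above)
    where
    constant : ∀ D → c * D + t ≤ partialSum f D → ∀ m → D ≤ m → f m ≡ c
    constant D above m D≤m with f m ≟ c | m≤n⇒∃[o]m+o≡n D≤m
    ... | yes f≡c | _      = f≡c
    ... | no f≢c  | e , refl = ⊥-elim (never (suc (D + e) , (begin
      c * suc (D + e) + suc t                  ≡⟨ rearrange c D e t ⟩
      suc c + (c * e + (c * D + t))            ≤⟨ +-mono-≤ c<f (+-monoʳ-≤ (c * e) above) ⟩
      f (D + e) + (c * e + partialSum f D)     ≤⟨ +-monoʳ-≤ (f (D + e)) (partialSum-lowerBound f c f≥c D e) ⟩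
      f (D + e) + partialSum f (e + D)         ≡⟨ cong (λ k → f (D + e) + partialSum f k) (+-comm e D) ⟩
      partialSum f (suc (D + e))               ∎)))
      where
      open ≤-Reasoning
      c<f : c < f (D + e)
      c<f = ≤∧≢⇒< (f≥c (D + e)) (λ c≡f → f≢c (sym c≡f))
      rearrange : ∀ c D e t → c * suc (D + e) + suc t ≡ suc c + (c * e + (c * D + t))
      rearrange = solve-∀

ones-*-lowerBound : ∀ w L x → (∀ j → x ≤ ones w j L) → ∀ N j → N * x ≤ ones w j (N * L)
ones-*-lowerBound w L x x≤ones zero    j = z≤n
ones-*-lowerBound w L x x≤ones (suc N) j =
  ≤-trans (+-mono-≤ (x≤ones j) (ones-*-lowerBound w L x x≤ones N (j + L)))
          (≤-reflexive (sym (ones-+ w j L (N * L))))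

slopeMulLe⇒factor-lowerBound : ∀ w a b → SlopeMulLe w a b →
                               ∀ L x → 1 ≤ L → (∀ j → x ≤ ones w j L) → a * x ≤ b * L
slopeMulLe⇒factor-lowerBound w a b slope (suc L) x _ x≤ones
  with a * x ≤? b * suc L | slope (suc L) (s≤s z≤n)
... | yes ax≤bL | _              = ax≤bL
... | no  ax≰bL | N , eventually =
  ⊥-elim (<⇒≱ (eventually i (≤-trans (n≤1+n N) (m≤m*n (suc N) (suc L))) (s≤s z≤n)) dense)
  where
  i : ℕ
  i = suc N * suc L
  dense : (suc L * b + 1) * i ≤ suc L * a * P w i
  dense = begin
    (suc L * b + 1) * (suc N * suc L)       ≡⟨ rearrange₁ L b N ⟩
    suc L * (suc N * suc (b * suc L))       ≤⟨ *-monoʳ-≤ (suc L) (*-monoʳ-≤ (suc N) (≰⇒> ax≰bL)) ⟩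
    suc L * (suc N * (a * x))               ≡⟨ rearrange₂ L N a x ⟩
    suc L * a * (suc N * x)
      ≤⟨ *-monoʳ-≤ (suc L * a) (ones-*-lowerBound w (suc L) x x≤ones (suc N) 0) ⟩
    suc L * a * P w i                       ∎
    where
    open ≤-Reasoning
    rearrange₁ : ∀ L b N → (suc L * b + 1) * (suc N * suc L) ≡ suc L * (suc N * suc (b * suc L))
    rearrange₁ = solve-∀
    rearrange₂ : ∀ L N a x → suc L * (suc N * (a * x)) ≡ suc L * a * (suc N * x)
    rearrange₂ = solve-∀

balanced⇒P-slope-bound : ∀ w a b → Balanced w → SlopeMulLe w a b → ∀ L → a * P w L ≤ b * L + a
balanced⇒P-slope-bound w a b bal slope zero = ≤-trans (≤-reflexive (*-zeroʳ a)) z≤n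
balanced⇒P-slope-bound w a b bal slope (suc L) with P w (suc L) in P≡
... | zero  = ≤-trans (≤-reflexive (*-zeroʳ a)) z≤n
... | suc x = begin
  a * suc x          ≡⟨ *-suc a x ⟩
  a + a * x
    ≤⟨ +-monoʳ-≤ a (slopeMulLe⇒factor-lowerBound w a b slope (suc L) x (s≤s z≤n) x≤ones) ⟩
  a + b * suc L      ≡⟨ +-comm a (b * suc L) ⟩
  b * suc L + a      ∎
  where
  open ≤-Reasoning
  x≤ones : ∀ j → x ≤ ones w j (suc L)
  x≤ones j = s≤s⁻¹ (subst₂ _≤_ P≡ (+-comm _ 1) (bal (suc L) 0 j))

sturmian-slope⇒window≤ : ∀ w c → Sturmian w → SlopeMulLe w (suc c) c → ∀ j → ones w j (suc c) ≤ c
sturmian-slope⇒window≤ w c (bal , ¬up) slope j with ones w j (suc c) ≤? c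
... | yes window≤ = window≤
... | no  window≰ =
  ⊥-elim (eventually≡lowerBound (λ d → ones w d n) c (c * n + n) c≤window windowSum-bound (¬up ∘ periodic))
  where
  n : ℕ
  n = suc c

  c≤window : ∀ d → c ≤ ones w d n
  c≤window d = s≤s⁻¹ (≤-trans (≰⇒> window≰) (≤-trans (bal n j d) (≤-reflexive (+-comm _ 1))))

  windowSum-bound : ∀ D → partialSum (λ d → ones w d n) D ≤ c * D + (c * n + n)
  windowSum-bound D = begin
    partialSum (λ d → ones w d n) D   ≤⟨ windowSum≤ w n D ⟩
    n * P w (n + D)                   ≤⟨ balanced⇒P-slope-bound w n c bal slope (n + D) ⟩
    c * (n + D) + n                   ≡⟨ rearrange c n D ⟩
    c * D + (c * n + n)               ∎
    where
    open ≤-Reasoning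
    rearrange : ∀ c n D → c * (n + D) + n ≡ c * D + (c * n + n)
    rearrange = solve-∀

  periodic : ∃[ D ] (∀ m → D ≤ m → ones w m n ≡ c) → UltimatelyPeriodic w
  periodic (D , constant) = n , D , s≤s z≤n , λ m D≤m →
    equal-window-weights⇒letter≡ w m n
      (trans (constant m D≤m) (sym (constant (suc m) (m≤n⇒m≤1+n D≤m))))

lemma6 : (w : Word) → Sturmian w →
    (PrefixNormal (true ∷w w) ⇔ Sturmian (false ∷w w)) ×
    (¬ Sturmian (false ∷w w) → (n : ℕ) → IsCeilInvOneMinusSlope w n →
    PrefixNormal (ones-prefix n w))
lemma6 w st = prefixNormal-true∷w⇔sturmian-false∷w w st , λ _ → prefixNormal-ones-prefix-ceil
  where
  prefixNormal-ones-prefix-ceil : (n : ℕ) → IsCeilInvOneMinusSlope w n → PrefixNormal (ones-prefix n w)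
  prefixNormal-ones-prefix-ceil zero    (() , _)
  prefixNormal-ones-prefix-ceil (suc c) (_ , slope , _) =
    prefixNormal-ones-prefix (suc c) w
      (window≤⇒prefix-bound w c (proj₁ st) (sturmian-slope⇒window≤ w c st slope))
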